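{- Let $n\ge 1$ and let $\mathsf A$ be the Manacher array of some string of length $n$. Then there exists a graph $G=(V,E)$ whose vertex set $V$ is a partition of $\{1,\dots,n\}$ into nonempty blocks such that: (i) for every proper vertex coloring $\psi:V\to\Sigma$ of $G$ using exactly $k$ colors, the string $T$ of length $n$ defined by $T[i]=\psi(X)$ for the unique block $X\in V$ containing $i$ has Manacher array $\mathsf A$ and contains exactly $k$ distinct symbols; and (ii) for every string $T$ of length $n$ with Manacher array $\mathsf A$, $T$ is constant on each block $X\in V$, and the map $\psi(X):=T[i]$ (for any $i\in X$) is a proper vertex coloring of $G$.
   Context: For a string $S$ and $1\le i\le j\le |S|$, $S[i..j]=S[i]\cdots S[j]$. A palindrome is a string equal to its reversal. The Manacher array of a string $S$ of length $n$ is the array $\mathsf A[1..2n-1]$ where, for $i=2k-1$, $\mathsf A[i]$ is the largest $r\ge 0$ with $1\le k-r\le k+r\le n$ such that $S[k-r..k+r]$ is a palindrome, and for $i=2k$, $\mathsf A[i]$ is the largest $r\ge 0$ with $1\le k-r+1\le k+r\le n$ such that $S[k-r+1..k+r]$ is a palindrome. A proper vertex coloring of $G$ is a map $\psi:V\to\Sigma$ with $\psi(u)\ne\psi(v)$ for every edge $\{u,v\}\in E$. -}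

module Defs where

open import Data.Nat using (ℕ; zero; suc; _+_; _*_; _∸_; _≤_; _<_)
open import Data.Fin using (Fin; toℕ)
open import Data.Product using (Σ; _×_; ∃; ∃-syntax)
open import Data.Sum using (_⊎_)
open import Relation.Binary.PropositionalEquality using (_≡_; _≢_)
open import Function.Definitions using (Injective; Surjective)

-- A string of length n over alphabet Σ: positions are 0-based (Fin n),
-- i.e. paper position p (1-based) is Fin element p - 1.
Str : Set → ℕ → Set
Str Alph n = Fin n → Alph

-- The substring S[a..b] (0-based positions a..b, possibly empty when b < a)
-- is a palindrome: it equals its reversal, i.e. S[a+j] = S[b-j] for all j.
IsPalindrome : {Alph : Set} {n : ℕ} → Str Alph n → ℕ → ℕ → Set
IsPalindrome {n = n} S a b =
  ∀ (p q : Fin n) → a ≤ toℕ p → a ≤ toℕ q → toℕ p + toℕ q ≡ a + b → S p ≡ S q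

-- Paper index i = 2k-1 (k 1-based): 1 ≤ k-r, k+r ≤ n, S[k-r..k+r] (1-based)
-- is a palindrome; 1-based [k-r..k+r] is 0-based [k-r-1 .. k+r-1].
OddRadius : {Alph : Set} {n : ℕ} → Str Alph n → ℕ → ℕ → Set
OddRadius {n = n} S k r =
  1 + r ≤ k × k + r ≤ n × IsPalindrome S (k ∸ r ∸ 1) (k + r ∸ 1)

-- Paper index i = 2k: 1 ≤ k-r+1, k+r ≤ n, S[k-r+1..k+r] (1-based) is a
-- palindrome; 1-based [k-r+1..k+r] is 0-based [k-r .. k+r-1].
EvenRadius : {Alph : Set} {n : ℕ} → Str Alph n → ℕ → ℕ → Set
EvenRadius {n = n} S k r =
  r ≤ k × k + r ≤ n × IsPalindrome S (k ∸ r) (k + r ∸ 1)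

Radius : {Alph : Set} {n : ℕ} → Str Alph n → ℕ → ℕ → Set
Radius S i r =
  (Σ ℕ λ k → i ≡ 2 * k ∸ 1 × 1 ≤ k × OddRadius S k r)
  ⊎ (Σ ℕ λ k → i ≡ 2 * k × EvenRadius S k r)

-- A : Fin (2n-1) → ℕ is the Manacher array of S; the Fin element j
-- stands for the paper's 1-based index i = j + 1.  A[i] is the largest
-- admissible radius.
IsManacherArray : {Alph : Set} {n : ℕ} → Str Alph n → (Fin (2 * n ∸ 1) → ℕ) → Set
IsManacherArray S A =
  ∀ (j : Fin _) → Radius S (suc (toℕ j)) (A j)
                × (∀ r → Radius S (suc (toℕ j)) r → r ≤ A j)

record Graph (m : ℕ) : Set₁ where
  field
    Adj    : Fin m → Fin m → Set
    sym    : ∀ {u v} → Adj u v → Adj v u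
    irrefl : ∀ {u} → Adj u u → ∀ {A : Set} → A

IsProperColoring : {Alph : Set} {m : ℕ} → Graph m → (Fin m → Alph) → Set
IsProperColoring G ψ = ∀ u v → Graph.Adj G u v → ψ u ≢ ψ v

NumDistinct : {Alph : Set} {m : ℕ} → (Fin m → Alph) → ℕ → Set
NumDistinct {Alph} {m} f k =
  Σ (Fin k → Alph) λ g →
    Injective _≡_ _≡_ g
    × (∀ j → ∃[ x ] f x ≡ g j)
    × (∀ x → ∃[ j ] g j ≡ f x)

{-# OPTIONS --safe #-}

-- Any string T with Manacher array A agrees on every pair of positions mirrored inside one of
-- the palindromes prescribed by A, and differs on the two positions just outside each of them
-- (otherwise that palindrome would extend).  Conversely, once A is realised by some string S,
-- these constraints force A to be the Manacher array of T.  So the blocks are the classes of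
-- the equivalence closure of "mirrored", the edges join the blocks of boundary pairs (no loops,
-- because S satisfies the constraints), and the strings with array A are exactly the proper
-- colourings read through the block map.
module Submission where

open import Defs
open import Data.Bool using (if_then_else_)
open import Data.Empty using (⊥-elim)
open import Data.Fin using (Fin; zero; suc; toℕ; fromℕ<)
open import Data.Fin.Properties using (any?; toℕ-injective; toℕ<n; toℕ-fromℕ<)
  renaming (_≟_ to _≟ᶠ_)
open import Data.List using (List; []; _∷_; allFin; cartesianProduct; filter)
open import Data.List.Membership.Propositional using (_∈_)
open import Data.List.Membership.Propositional.Properties
  using (∈-filter⁺; ∈-cartesianProduct⁺; ∈-allFin)
open import Data.List.Relation.Unary.All as All using (All; []; _∷_)
open import Data.List.Relation.Unary.All.Properties using (all-filter)
open import Data.List.Relation.Unary.Any using (here; there)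
open import Data.Nat
  using (ℕ; zero; suc; _+_; _*_; _∸_; _≤_; _<_; _≤?_; _≟_; s≤s; z≤n; ⌊_/2⌋; ⌈_/2⌉)
open import Data.Nat.Properties
open import Data.Product using (Σ; _×_; ∃; ∃₂; ∃-syntax; _,_; proj₁; proj₂; uncurry)
open import Data.Sum using (_⊎_; inj₁; inj₂; swap)
open import Function using (_∘_; _on_; id)
open import Function.Consequences.Propositional using (strictlySurjective⇒surjective)
open import Function.Definitions using (Injective; Surjective; StrictlySurjective)
open import Level using (0ℓ)
open import Relation.Binary.Core using (Rel; _⇒_; _=[_]⇒_)
open import Relation.Binary.Definitions using (Decidable; DecidableEquality)
open import Relation.Binary.PropositionalEquality
  using (_≡_; _≢_; refl; sym; trans; cong; cong₂; subst; subst₂; module ≡-Reasoning)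
open import Relation.Nullary using (yes; no; does)
open import Relation.Nullary.Decidable using (dec-true; _×-dec_)

record Image {A : Set} {n : ℕ} (f : Fin n → A) : Set where
  field
    m            : ℕ
    β            : Fin n → Fin m
    ι            : Fin m → A
    β-surjective : StrictlySurjective _≡_ β
    ι-injective  : Injective _≡_ _≡_ ι
    ι∘β≗f        : ∀ x → ι (β x) ≡ f x

  f≡⇒β≡ : (_≡_ on f) ⇒ (_≡_ on β)
  f≡⇒β≡ {x} {y} fx≡fy = ι-injective (trans (ι∘β≗f x) (trans fx≡fy (sym (ι∘β≗f y))))

  β≡⇒f≡ : (_≡_ on β) ⇒ (_≡_ on f)
  β≡⇒f≡ {x} {y} βx≡βy = trans (sym (ι∘β≗f x)) (trans (cong ι βx≡βy) (ι∘β≗f y))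

image : ∀ {A : Set} {n} → DecidableEquality A → (f : Fin n → A) → Image f
image {n = zero} _ f = record
  { m = 0 ; β = λ () ; ι = λ () ; β-surjective = λ ()
  ; ι-injective = λ { {()} } ; ι∘β≗f = λ ()
  }
image {A} {suc n} _≟_ f with image _≟_ (f ∘ suc) | any? (λ y → f zero ≟ f (suc y))
... | I | yes (y , f0≡fy) = record
  { m = m ; β = β₁ ; ι = ι ; β-surjective = β₁-surjective
  ; ι-injective = ι-injective ; ι∘β≗f = ι∘β₁≗f
  }
  where
    open Image I
    β₁ : Fin (suc n) → Fin m
    β₁ zero    = β y
    β₁ (suc x) = β x
    β₁-surjective : StrictlySurjective _≡_ β₁
    β₁-surjective k = suc (proj₁ (β-surjective k)) , proj₂ (β-surjective k)
    ι∘β₁≗f : ∀ x → ι (β₁ x) ≡ f x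
    ι∘β₁≗f zero    = trans (ι∘β≗f y) (sym f0≡fy)
    ι∘β₁≗f (suc x) = ι∘β≗f x
... | I | no f0∉im = record
  { m = suc m ; β = β₁ ; ι = ι₁ ; β-surjective = β₁-surjective
  ; ι-injective = ι₁-injective ; ι∘β≗f = ι₁∘β₁≗f
  }
  where
    open Image I
    β₁ : Fin (suc n) → Fin (suc m)
    β₁ zero    = zero
    β₁ (suc x) = suc (β x)
    ι₁ : Fin (suc m) → A
    ι₁ zero    = f zero
    ι₁ (suc k) = ι k
    β₁-surjective : StrictlySurjective _≡_ β₁
    β₁-surjective zero    = zero , refl
    β₁-surjective (suc k) = suc (proj₁ (β-surjective k)) , cong suc (proj₂ (β-surjective k))
    f0≢ι : ∀ k → f zero ≢ ι k
    f0≢ι k f0≡ιk with x , refl ← β-surjective k = f0∉im (x , trans f0≡ιk (ι∘β≗f x))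
    ι₁-injective : Injective _≡_ _≡_ ι₁
    ι₁-injective {zero}  {zero}  _ = refl
    ι₁-injective {zero}  {suc l} e = ⊥-elim (f0≢ι l e)
    ι₁-injective {suc k} {zero}  e = ⊥-elim (f0≢ι k (sym e))
    ι₁-injective {suc k} {suc l} e = cong suc (ι-injective e)
    ι₁∘β₁≗f : ∀ x → ι₁ (β₁ x) ≡ f x
    ι₁∘β₁≗f zero    = refl
    ι₁∘β₁≗f (suc x) = ι∘β≗f x

-- The last two fields say that ker β is the equivalence closure of R.
record Quotient {n : ℕ} (R : Rel (Fin n) 0ℓ) : Set₁ where
  field
    m            : ℕ
    β            : Fin n → Fin m
    β-surjective : StrictlySurjective _≡_ β
    β-identifies : R =[ β ]⇒ _≡_
    β-universal  : ∀ {B : Set} {T : Fin n → B} → R =[ T ]⇒ _≡_ → (_≡_ on β) =[ T ]⇒ _≡_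

module _ {n : ℕ} where

  relabel : Fin n → Fin n → Fin n → Fin n
  relabel old new v = if does (v ≟ᶠ old) then new else v

  relabel-cases : ∀ old new v → (relabel old new v ≡ new × v ≡ old) ⊎ relabel old new v ≡ v
  relabel-cases old new v with v ≟ᶠ old
  ... | yes v≡old = inj₁ (refl , v≡old)
  ... | no _      = inj₂ refl

  relabel-old : ∀ old new → relabel old new old ≡ new
  relabel-old old new = cong (if_then new else old) (dec-true (old ≟ᶠ old) refl)

  relabel-new : ∀ old new → relabel old new new ≡ new
  relabel-new old new with relabel-cases old new new
  ... | inj₁ (e , _) = e
  ... | inj₂ e       = e

  merge : (Fin n → Fin n) → Fin n → Fin n → Fin n → Fin n
  merge L p q = relabel (L q) (L p) ∘ L

  merge-merges : ∀ L p q → merge L p q p ≡ merge L p q q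
  merge-merges L p q = trans (relabel-new (L q) (L p)) (sym (relabel-old (L q) (L p)))

  merge-relabels : ∀ {B : Set} {T : Fin n → B} L p q → (_≡_ on L) =[ T ]⇒ _≡_ → T p ≡ T q
                 → ∀ x → ∃[ x′ ] merge L p q x ≡ L x′ × T x ≡ T x′
  merge-relabels L p q L⇒T Tp≡Tq x with relabel-cases (L q) (L p) (L x)
  ... | inj₁ (m≡Lp , Lx≡Lq) = p , m≡Lp , trans (L⇒T Lx≡Lq) (sym Tp≡Tq)
  ... | inj₂ m≡Lx           = x , m≡Lx , refl

  merge-sound : ∀ {B : Set} {T : Fin n → B} L p q → (_≡_ on L) =[ T ]⇒ _≡_ → T p ≡ T q
              → (_≡_ on merge L p q) =[ T ]⇒ _≡_
  merge-sound {T = T} L p q L⇒T Tp≡Tq {x} {y} mx≡my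
    with x′ , mx≡Lx′ , Tx≡Tx′ ← merge-relabels L p q L⇒T Tp≡Tq x
       | y′ , my≡Ly′ , Ty≡Ty′ ← merge-relabels L p q L⇒T Tp≡Tq y = begin
      T x  ≡⟨ Tx≡Tx′ ⟩
      T x′ ≡⟨ L⇒T (trans (sym mx≡Lx′) (trans mx≡my my≡Ly′)) ⟩
      T y′ ≡⟨ Ty≡Ty′ ⟨
      T y  ∎
    where open ≡-Reasoning

  mergeAll : List (Fin n × Fin n) → (Fin n → Fin n) → Fin n → Fin n
  mergeAll []             L = L
  mergeAll ((p , q) ∷ ps) L = mergeAll ps (merge L p q)

  mergeAll-preserves : ∀ ps L → (_≡_ on L) ⇒ (_≡_ on mergeAll ps L)
  mergeAll-preserves []             L e = e
  mergeAll-preserves ((p , q) ∷ ps) L e =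
    mergeAll-preserves ps (merge L p q) (cong (relabel (L q) (L p)) e)

  mergeAll-merges : ∀ {p q} ps L → (p , q) ∈ ps → mergeAll ps L p ≡ mergeAll ps L q
  mergeAll-merges {p} {q} (_ ∷ ps) L (here refl) =
    mergeAll-preserves ps (merge L p q) (merge-merges L p q)
  mergeAll-merges ((p′ , q′) ∷ ps) L (there pq∈ps) =
    mergeAll-merges ps (merge L p′ q′) pq∈ps

  mergeAll-sound : ∀ {B : Set} {T : Fin n → B} ps L → All (λ (p , q) → T p ≡ T q) ps
                 → (_≡_ on L) =[ T ]⇒ _≡_ → (_≡_ on mergeAll ps L) =[ T ]⇒ _≡_
  mergeAll-sound []             L []             L⇒T = L⇒T
  mergeAll-sound ((p , q) ∷ ps) L (Tp≡Tq ∷ eqs) L⇒T =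
    mergeAll-sound ps (merge L p q) eqs (merge-sound L p q L⇒T Tp≡Tq)

quotient : ∀ {n} {R : Rel (Fin n) 0ℓ} → Decidable R → Quotient R
quotient {n} {R} R? = record
  { m = m ; β = β ; β-surjective = β-surjective
  ; β-identifies = f≡⇒β≡ ∘ L-identifies
  ; β-universal  = λ R⇒T → L-universal R⇒T ∘ β≡⇒f≡
  }
  where
    pairs related : List (Fin n × Fin n)
    pairs   = cartesianProduct (allFin n) (allFin n)
    related = filter (uncurry R?) pairs
    L : Fin n → Fin n
    L = mergeAll related id
    L-identifies : R =[ L ]⇒ _≡_
    L-identifies Rpq = mergeAll-merges related id
      (∈-filter⁺ (uncurry R?) (∈-cartesianProduct⁺ (∈-allFin _) (∈-allFin _)) Rpq)
    L-universal : ∀ {B : Set} {T : Fin n → B} → R =[ T ]⇒ _≡_ → (_≡_ on L) =[ T ]⇒ _≡_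
    L-universal {T = T} R⇒T =
      mergeAll-sound related id (All.map R⇒T (all-filter (uncurry R?) pairs)) (cong T)
    open Image (image _≟ᶠ_ L)

module _ {n m : ℕ} (β : Fin n → Fin m) (E : Rel (Fin n) 0ℓ) (loopless : E =[ β ]⇒ _≢_) where

  blockGraph : Graph m
  blockGraph = record
    { Adj    = λ X Y → ∃₂ λ p q → (E p q ⊎ E q p) × β p ≡ X × β q ≡ Y
    ; sym    = λ (p , q , e , βp≡X , βq≡Y) → q , p , swap e , βq≡Y , βp≡X
    ; irrefl = λ (p , q , e , βp≡X , βq≡X) → ⊥-elim (separated e (trans βp≡X (sym βq≡X)))
    }
    where
      separated : ∀ {p q} → E p q ⊎ E q p → β p ≢ β q
      separated (inj₁ Epq) = loopless Epq
      separated (inj₂ Eqp) = loopless Eqp ∘ sym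

  proper⇒separates : ∀ {Alph : Set} {ψ : Fin m → Alph}
                   → IsProperColoring blockGraph ψ → E =[ ψ ∘ β ]⇒ _≢_
  proper⇒separates proper {p} {q} Epq = proper (β p) (β q) (p , q , inj₁ Epq , refl , refl)

  separates⇒proper : ∀ {Alph : Set} {ψ : Fin m → Alph}
                   → E =[ ψ ∘ β ]⇒ _≢_ → IsProperColoring blockGraph ψ
  separates⇒proper separates _ _ (p , q , inj₁ Epq , refl , refl) = separates Epq
  separates⇒proper separates _ _ (p , q , inj₂ Eqp , refl , refl) = separates Eqp ∘ sym

numDistinct-∘-surjective : ∀ {Alph : Set} {n m k} {β : Fin n → Fin m} {ψ : Fin m → Alph}
  → StrictlySurjective _≡_ β → NumDistinct ψ k → NumDistinct (ψ ∘ β) k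
numDistinct-∘-surjective {β = β} {ψ} β-surjective (g , g-injective , g-hits , g-covers) =
  g , g-injective , hits , g-covers ∘ β
  where
    hits : ∀ j → ∃[ x ] ψ (β x) ≡ g j
    hits j with g-hits j
    ... | X , ψX≡gj with β-surjective X
    ...   | x , refl = x , ψX≡gj

descend : ∀ {Alph : Set} {n m} {β : Fin n → Fin m} {T : Fin n → Alph}
  → StrictlySurjective _≡_ β → (_≡_ on β) =[ T ]⇒ _≡_
  → Σ (Fin m → Alph) λ ψ → ∀ i → ψ (β i) ≡ T i
descend {β = β} {T} β-surjective β⇒T =
  T ∘ proj₁ ∘ β-surjective , λ i → β⇒T (proj₂ (β-surjective (β i)))

data Parity : ℕ → Set where
  even : ∀ h → Parity (h + h)
  odd  : ∀ h → Parity (suc (h + h))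

parity : ∀ j → Parity j
parity zero = even 0
parity (suc j) with parity j
... | even h = odd h
... | odd h  = subst Parity (cong suc (+-suc h h)) (even (suc h))

2*[1+k]∸1≡1+2k : ∀ k → 2 * suc k ∸ 1 ≡ suc (k + k)
2*[1+k]∸1≡1+2k k = trans (cong (λ x → k + suc x) (+-identityʳ k)) (+-suc k k)

2*[1+k]≡2+2k : ∀ k → 2 * suc k ≡ suc (suc (k + k))
2*[1+k]≡2+2k k = cong suc (2*[1+k]∸1≡1+2k k)

[1+k∸r]∸1≡k∸r : ∀ {k r} → r ≤ k → suc k ∸ r ∸ 1 ≡ k ∸ r
[1+k∸r]∸1≡k∸r r≤k = cong (_∸ 1) (+-∸-assoc 1 r≤k)

module _ {Alph : Set} {n : ℕ} (T : Str Alph n) where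

  PalindromicRadius : ℕ → ℕ → ℕ → Set
  PalindromicRadius c f r = r ≤ c × suc (f + r) ≤ n × IsPalindrome T (c ∸ r) (f + r)

  -- At the 0-based Manacher index j (paper index j + 1) the palindrome of radius r is
  -- T[⌈j/2⌉ ∸ r .. ⌊j/2⌋ + r], for odd and even centres alike.
  CentredRadius : ℕ → ℕ → Set
  CentredRadius j = PalindromicRadius ⌈ j /2⌉ ⌊ j /2⌋

  radius⇒centredRadius : ∀ j r → Radius T (suc j) r → CentredRadius j r
  radius⇒centredRadius j r (inj₁ (zero , _ , () , _))
  radius⇒centredRadius j r (inj₁ (suc k , i≡2k+1 , _ , s≤s r≤k , bound , pal))
    with refl ← suc-injective (trans i≡2k+1 (2*[1+k]∸1≡1+2k k)) =
    subst₂ (λ c f → PalindromicRadius c f r) (n≡⌈n+n/2⌉ k) (n≡⌊n+n/2⌋ k)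
      (r≤k , bound , subst (λ lo → IsPalindrome T lo (k + r)) ([1+k∸r]∸1≡k∸r r≤k) pal)
  radius⇒centredRadius j r (inj₂ (zero , () , _))
  radius⇒centredRadius j r (inj₂ (suc k , i≡2k+2 , radius))
    with refl ← suc-injective (trans i≡2k+2 (2*[1+k]≡2+2k k)) =
    subst₂ (λ c f → PalindromicRadius (suc c) f r) (n≡⌊n+n/2⌋ k) (n≡⌈n+n/2⌉ k) radius

  centredRadius⇒radius : ∀ j r → CentredRadius j r → Radius T (suc j) r
  centredRadius⇒radius j r radius with parity j
  ... | even h with r≤h , bound , pal ← subst₂ (λ c f → PalindromicRadius c f r)
                                          (sym (n≡⌈n+n/2⌉ h)) (sym (n≡⌊n+n/2⌋ h)) radius =
    inj₁ (suc h , sym (2*[1+k]∸1≡1+2k h) , s≤s z≤n , s≤s r≤h , bound ,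
          subst (λ lo → IsPalindrome T lo (h + r)) (sym ([1+k∸r]∸1≡k∸r r≤h)) pal)
  ... | odd h =
    inj₂ (suc h , sym (2*[1+k]≡2+2k h) ,
          subst₂ (λ c f → PalindromicRadius (suc c) f r)
            (sym (n≡⌊n+n/2⌋ h)) (sym (n≡⌈n+n/2⌉ h)) radius)

m∸o+[n+o]≡m+n : ∀ {m o} n → o ≤ m → m ∸ o + (n + o) ≡ m + n
m∸o+[n+o]≡m+n {m} {o} n o≤m = begin
  m ∸ o + (n + o) ≡⟨ cong (m ∸ o +_) (+-comm n o) ⟩
  m ∸ o + (o + n) ≡⟨ +-assoc (m ∸ o) o n ⟨
  m ∸ o + o + n   ≡⟨ cong (_+ n) (m∸n+n≡m o≤m) ⟩
  m + n           ∎
  where open ≡-Reasoning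

palindrome-extend : ∀ {Alph : Set} {n hi} {T : Str Alph n} (p q : Fin n)
  → toℕ q ≡ suc hi → T p ≡ T q
  → IsPalindrome T (suc (toℕ p)) hi → IsPalindrome T (toℕ p) (toℕ q)
palindrome-extend {hi = hi} {T} p q q≡1+hi Tp≡Tq pal p′ q′ p≤p′ p≤q′ sum
  with m≤n⇒m<n∨m≡n p≤p′ | m≤n⇒m<n∨m≡n p≤q′
... | inj₂ p≡p′ | _ =
  subst₂ (λ u v → T u ≡ T v) (toℕ-injective p≡p′)
    (toℕ-injective (sym (+-cancelˡ-≡ (toℕ p) _ _ (trans (cong (_+ toℕ q′) p≡p′) sum)))) Tp≡Tq
... | inj₁ _ | inj₂ p≡q′ =
  subst₂ (λ u v → T u ≡ T v) (toℕ-injective (sym p′≡q)) (toℕ-injective p≡q′) (sym Tp≡Tq)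
  where
    open ≡-Reasoning
    p′≡q : toℕ p′ ≡ toℕ q
    p′≡q = +-cancelʳ-≡ (toℕ p) _ _ (begin
      toℕ p′ + toℕ p  ≡⟨ cong (toℕ p′ +_) p≡q′ ⟩
      toℕ p′ + toℕ q′ ≡⟨ sum ⟩
      toℕ p + toℕ q   ≡⟨ +-comm (toℕ p) (toℕ q) ⟩
      toℕ q + toℕ p   ∎)
... | inj₁ p<p′ | inj₁ p<q′ =
  pal p′ q′ p<p′ p<q′ (trans sum (trans (cong (toℕ p +_) q≡1+hi) (+-suc (toℕ p) hi)))

module _ {n : ℕ} (A : Fin (2 * n ∸ 1) → ℕ) where

  private
    c f : Fin (2 * n ∸ 1) → ℕ
    c j = ⌈ toℕ j /2⌉
    f j = ⌊ toℕ j /2⌋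
    lo hi : Fin (2 * n ∸ 1) → ℕ
    lo j = c j ∸ A j
    hi j = f j + A j

  MirroredPair : Rel (Fin n) 0ℓ
  MirroredPair p q = ∃[ j ] lo j ≤ toℕ p × lo j ≤ toℕ q × toℕ p + toℕ q ≡ lo j + hi j

  mirroredPair? : Decidable MirroredPair
  mirroredPair? p q = any? λ j →
    (lo j ≤? toℕ p) ×-dec (lo j ≤? toℕ q) ×-dec (toℕ p + toℕ q ≟ lo j + hi j)

  -- The positions just outside the palindrome of radius A j; the condition A j < c j
  -- rules out a palindrome touching the left end, and q : Fin n one touching the right end.
  BoundaryPair : Rel (Fin n) 0ℓ
  BoundaryPair p q = ∃[ j ] A j < c j × toℕ p ≡ c j ∸ suc (A j) × toℕ q ≡ f j + suc (A j)

  longer-palindrome⇒boundary-equal : ∀ {Alph : Set} {T : Str Alph n} j r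
    → A j < r → CentredRadius T (toℕ j) r → ∃₂ λ p q → BoundaryPair p q × T p ≡ T q
  longer-palindrome⇒boundary-equal j r a<r (r≤c , r-bound , r-pal) =
    P , Q , (j , a<c , toℕ-fromℕ< P<n , toℕ-fromℕ< Q<n) , r-pal P Q lo≤P lo≤Q sum
    where
      a<c : A j < c j
      a<c = ≤-trans a<r r≤c
      c≤Q : c j ≤ f j + suc (A j)
      c≤Q = ≤-trans (⌊n/2⌋-mono (n≤1+n (suc (toℕ j))))
              (≤-trans (s≤s (m≤m+n (f j) (A j))) (≤-reflexive (sym (+-suc (f j) (A j)))))
      Q<n : f j + suc (A j) < n
      Q<n = ≤-trans (s≤s (+-monoʳ-≤ (f j) a<r)) r-bound
      P<n : c j ∸ suc (A j) < n
      P<n = ≤-<-trans (≤-trans (m∸n≤m (c j) (suc (A j))) c≤Q) Q<n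
      P Q : Fin n
      P = fromℕ< P<n
      Q = fromℕ< Q<n
      lo≤P : c j ∸ r ≤ toℕ P
      lo≤P = subst (c j ∸ r ≤_) (sym (toℕ-fromℕ< P<n)) (∸-monoʳ-≤ (c j) a<r)
      lo≤Q : c j ∸ r ≤ toℕ Q
      lo≤Q = subst (c j ∸ r ≤_) (sym (toℕ-fromℕ< Q<n)) (≤-trans (m∸n≤m (c j) r) c≤Q)
      sum : toℕ P + toℕ Q ≡ c j ∸ r + (f j + r)
      sum = begin
        toℕ P + toℕ Q                       ≡⟨ cong₂ _+_ (toℕ-fromℕ< P<n) (toℕ-fromℕ< Q<n) ⟩
        c j ∸ suc (A j) + (f j + suc (A j)) ≡⟨ m∸o+[n+o]≡m+n (f j) a<c ⟩
        c j + f j                           ≡⟨ m∸o+[n+o]≡m+n (f j) r≤c ⟨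
        c j ∸ r + (f j + r)                 ∎
        where open ≡-Reasoning

  module _ {Alph : Set} {T : Str Alph n} (T-manacher : IsManacherArray T A) where

    manacher⇒palindromic : ∀ j → CentredRadius T (toℕ j) (A j)
    manacher⇒palindromic j = radius⇒centredRadius T _ _ (proj₁ (T-manacher j))

    manacher⇒mirrored-equal : MirroredPair =[ T ]⇒ _≡_
    manacher⇒mirrored-equal (j , lo≤p , lo≤q , sum) =
      proj₂ (proj₂ (manacher⇒palindromic j)) _ _ lo≤p lo≤q sum

    manacher⇒boundary-distinct : BoundaryPair =[ T ]⇒ _≢_
    manacher⇒boundary-distinct {p} {q} (j , a<c , p≡ , q≡) Tp≡Tq =
      1+n≰n (proj₂ (T-manacher j) (suc (A j)) (centredRadius⇒radius T _ _ longer))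
      where
        pal : IsPalindrome T (suc (toℕ p)) (hi j)
        pal = subst (λ l → IsPalindrome T l (hi j)) (trans (+-∸-assoc 1 a<c) (cong suc (sym p≡)))
                (proj₂ (proj₂ (manacher⇒palindromic j)))
        longer : CentredRadius T (toℕ j) (suc (A j))
        longer = a<c , subst (_< n) q≡ (toℕ<n q) , subst₂ (IsPalindrome T) p≡ q≡
                 (palindrome-extend p q (trans q≡ (+-suc (f j) (A j))) Tp≡Tq pal)

  -- S is only used to know that the palindromes prescribed by A fit inside the string.
  mirrored-equal⇒boundary-distinct⇒manacher : ∀ {Alph Alph′ : Set} {S : Str Alph′ n} {T : Str Alph n}
    → IsManacherArray S A → MirroredPair =[ T ]⇒ _≡_ → BoundaryPair =[ T ]⇒ _≢_
    → IsManacherArray T A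
  mirrored-equal⇒boundary-distinct⇒manacher {T = T} S-manacher mirrored-equal boundary-distinct j =
    centredRadius⇒radius T _ _ (a≤c , bound , pal) , maximal
    where
      pal : IsPalindrome T (lo j) (hi j)
      pal p q lo≤p lo≤q sum = mirrored-equal (j , lo≤p , lo≤q , sum)
      a≤c : A j ≤ c j
      a≤c = proj₁ (manacher⇒palindromic S-manacher j)
      bound : suc (hi j) ≤ n
      bound = proj₁ (proj₂ (manacher⇒palindromic S-manacher j))
      maximal : ∀ r → Radius T (suc (toℕ j)) r → r ≤ A j
      maximal r radius with r ≤? A j
      ... | yes r≤a = r≤a
      ... | no r≰a with p , q , Bpq , Tp≡Tq ← longer-palindrome⇒boundary-equal j r (≰⇒> r≰a)
                                                (radius⇒centredRadius T _ _ radius) =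
        ⊥-elim (boundary-distinct Bpq Tp≡Tq)

theorem2 : ∀ (n : ℕ) → 1 ≤ n → (A : Fin (2 * n ∸ 1) → ℕ)
    → (Σ Set λ Σ₀ → Σ (Str Σ₀ n) λ S → IsManacherArray S A)
    → Σ ℕ λ m → Σ (Fin n → Fin m) λ β → Σ (Graph m) λ G →
        Surjective _≡_ _≡_ β
        × (∀ (Σ' : Set) (ψ : Fin m → Σ') (k : ℕ) → IsProperColoring G ψ → NumDistinct ψ k
             → IsManacherArray (λ i → ψ (β i)) A × NumDistinct (λ i → ψ (β i)) k)
        × (∀ (Σ' : Set) (T : Str Σ' n) → IsManacherArray T A
             → (∀ i j → β i ≡ β j → T i ≡ T j)
               × (Σ (Fin m → Σ') λ ψ → (∀ i → ψ (β i) ≡ T i) × IsProperColoring G ψ))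
theorem2 n _ A (_ , S , S-manacher) =
  m , β , G , strictlySurjective⇒surjective β-surjective ,
  (λ _ ψ _ proper ψ-distinct →
     mirrored-equal⇒boundary-distinct⇒manacher A S-manacher (cong ψ ∘ β-identifies)
       (proper⇒separates β (BoundaryPair A) boundary-separated proper) ,
     numDistinct-∘-surjective β-surjective ψ-distinct) ,
  λ _ T T-manacher →
    let T-blockwise = β-universal (manacher⇒mirrored-equal A T-manacher)
        ψ , ψ∘β≗T = descend β-surjective T-blockwise
    in (λ _ _ → T-blockwise) , ψ , ψ∘β≗T ,
       separates⇒proper β (BoundaryPair A) boundary-separated λ {p} {q} Bpq ψβp≡ψβq →
         manacher⇒boundary-distinct A T-manacher Bpq
           (trans (sym (ψ∘β≗T p)) (trans ψβp≡ψβq (ψ∘β≗T q)))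
  where
    open Quotient (quotient (mirroredPair? {n} A))
    boundary-separated : BoundaryPair A =[ β ]⇒ _≢_
    boundary-separated Bpq βp≡βq = manacher⇒boundary-distinct A S-manacher Bpq
      (β-universal (manacher⇒mirrored-equal A S-manacher) βp≡βq)
    G : Graph m
    G = blockGraph β (BoundaryPair A) boundary-separated
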